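{- For all $n\ge0$, \[ p_n^2=p_n+2\sum_{k=0}^{n-5}\sum_{r=5}^{n-k}c_{r-5}p_{k}p_{n-k-r}^2 . \]
   Context: The Narayana's cows numbers $c_n$ are defined by $c_n=\delta_{n,0}+c_{n-1}+c_{n-3}$ for $n\ge0$, $c_n=0$ for $n<0$. The Padovan numbers $p_n$ are defined by $p_n=\delta_{n,0}+p_{n-2}+p_{n-3}$ for $n\ge0$, $p_n=0$ for $n<0$. $\delta_{i,j}$ is $1$ if $i=j$ and $0$ otherwise; empty sums are $0$. -}

module Defs where

open import Data.Nat using (ℕ; zero; suc; _+_; _*_; _∸_)

-- Narayana's cows numbers: c_n = δ_{n,0} + c_{n-1} + c_{n-3}, c_n = 0 for n < 0
cows : ℕ → ℕ
cows 0 = 1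
cows 1 = cows 0
cows 2 = cows 1
cows (suc (suc (suc n))) = cows (suc (suc n)) + cows n

-- Padovan numbers: p_n = δ_{n,0} + p_{n-2} + p_{n-3}, p_n = 0 for n < 0
pad : ℕ → ℕ
pad 0 = 1
pad 1 = 0
pad 2 = pad 0
pad (suc (suc (suc n))) = pad (suc n) + pad n

sumRange : ℕ → ℕ → (ℕ → ℕ) → ℕ
sumRange a zero f = 0
sumRange a (suc m) f = f a + sumRange (suc a) m f

-- Σ_{i=a}^{b} f i over integers a ≤ i ≤ b, with b given as an integer b = t - s
-- we only need: Σ_{i=a}^{t-s} with number of terms max(0, t - s - a + 1)
-- which equals (t + 1) ∸ (s + a) in ℕ.
sumFromTo : (a t s : ℕ) → (ℕ → ℕ) → ℕ
sumFromTo a t s f = sumRange a ((suc t) ∸ (s + a)) f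

rhs18 : ℕ → ℕ
rhs18 n = pad n + 2 * sumFromTo 0 n 5 (λ k →
            sumFromTo 5 (n ∸ k) 0 (λ r →
              cows (r ∸ 5) * pad k * (pad (n ∸ k ∸ r) * pad (n ∸ k ∸ r))))

{-# OPTIONS --safe #-}
module Submission where

-- Write P(x), C(x) for the generating functions of pad and cows, so that
-- (1 - x² - x³) P = 1 and (1 - x - x³) C = 1.  The squares pad² obey
--   pad²(m+5) = pad²(m+3) + pad²(m+2) + 2 (C·pad²)_m,
-- by induction, using the polynomial identity pad²(m+8) + pad²(m+4) + pad²(m+2)
-- = pad²(m+7) + pad²(m+6) + pad²(m+5) + pad²(m+3) and the fact that C·pad² satisfies the
-- cows recurrence with forcing term pad².  Dividing by 1 - x² - x³ gives pad²(N+5) = pad(N+5)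
-- + 2 (P·C·pad²)_N, and the double sum of the theorem is this coefficient written out.

open import Defs
open import Data.Nat using (ℕ; zero; suc; _+_; _*_; _∸_)
open import Data.Nat.Properties using (+-cancelʳ-≡; *-zeroʳ; *-distribˡ-+; *-distribʳ-+)
open import Data.Nat.Tactic.RingSolver using (solve-∀)
open import Function using (_∘_)
open import Relation.Binary.PropositionalEquality using (_≡_; refl; sym; trans; cong; cong₂)
open Relation.Binary.PropositionalEquality.≡-Reasoning

sumRange-cong : ∀ a m {f g : ℕ → ℕ} → (∀ k → f k ≡ g k) → sumRange a m f ≡ sumRange a m g
sumRange-cong a zero    f≗g = refl
sumRange-cong a (suc m) f≗g = cong₂ _+_ (f≗g a) (sumRange-cong (suc a) m f≗g)

sumRange-suc : ∀ a m (f : ℕ → ℕ) → sumRange (suc a) m f ≡ sumRange a m (f ∘ suc)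
sumRange-suc a zero    f = refl
sumRange-suc a (suc m) f = cong (f (suc a) +_) (sumRange-suc (suc a) m f)

sumRange-shift : ∀ d a m (f : ℕ → ℕ) → sumRange (d + a) m f ≡ sumRange a m (f ∘ (d +_))
sumRange-shift zero    a m f = refl
sumRange-shift (suc d) a m f = trans (sumRange-suc (d + a) m f) (sumRange-shift d a m (f ∘ suc))

sumRange-+ : ∀ a m (f g : ℕ → ℕ) →
             sumRange a m (λ k → f k + g k) ≡ sumRange a m f + sumRange a m g
sumRange-+ a zero    f g = refl
sumRange-+ a (suc m) f g = begin
  f a + g a + sumRange (suc a) m (λ k → f k + g k)
    ≡⟨ cong (f a + g a +_) (sumRange-+ (suc a) m f g) ⟩
  f a + g a + (sumRange (suc a) m f + sumRange (suc a) m g)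
    ≡⟨ interchange (f a) (g a) _ _ ⟩
  f a + sumRange (suc a) m f + (g a + sumRange (suc a) m g) ∎
  where
  interchange : ∀ x y z w → x + y + (z + w) ≡ x + z + (y + w)
  interchange = solve-∀

sumRange-*ˡ : ∀ a m x (f : ℕ → ℕ) → sumRange a m (λ k → x * f k) ≡ x * sumRange a m f
sumRange-*ˡ a zero    x f = sym (*-zeroʳ x)
sumRange-*ˡ a (suc m) x f =
  trans (cong (x * f a +_) (sumRange-*ˡ (suc a) m x f)) (sym (*-distribˡ-+ x (f a) _))

_⋆_ : (ℕ → ℕ) → (ℕ → ℕ) → ℕ → ℕ
(f ⋆ g) n = sumRange 0 (suc n) (λ k → f k * g (n ∸ k))

⋆-suc : ∀ f g n → (f ⋆ g) (suc n) ≡ f 0 * g (suc n) + ((f ∘ suc) ⋆ g) n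
⋆-suc f g n = cong (f 0 * g (suc n) +_) (sumRange-suc 0 (suc n) (λ k → f k * g (suc n ∸ k)))

⋆-suc² : ∀ f g n →
         (f ⋆ g) (2 + n) ≡ f 0 * g (2 + n) + (f 1 * g (1 + n) + ((f ∘ (2 +_)) ⋆ g) n)
⋆-suc² f g n = trans (⋆-suc f g (1 + n)) (cong (f 0 * g (2 + n) +_) (⋆-suc (f ∘ suc) g n))

⋆-suc³ : ∀ f g n → (f ⋆ g) (3 + n) ≡
         f 0 * g (3 + n) + (f 1 * g (2 + n) + (f 2 * g (1 + n) + ((f ∘ (3 +_)) ⋆ g) n))
⋆-suc³ f g n = trans (⋆-suc f g (2 + n)) (cong (f 0 * g (3 + n) +_) (⋆-suc² (f ∘ suc) g n))

⋆-distribʳ-+ : ∀ f f′ g n → ((λ k → f k + f′ k) ⋆ g) n ≡ (f ⋆ g) n + (f′ ⋆ g) n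
⋆-distribʳ-+ f f′ g n =
  trans (sumRange-cong 0 (suc n) (λ k → *-distribʳ-+ (g (n ∸ k)) (f k) (f′ k)))
        (sumRange-+ 0 (suc n) (λ k → f k * g (n ∸ k)) (λ k → f′ k * g (n ∸ k)))

cows⋆-rec : ∀ g m → (cows ⋆ g) (3 + m) ≡ g (3 + m) + (cows ⋆ g) (2 + m) + (cows ⋆ g) m
cows⋆-rec g m = begin
  (cows ⋆ g) (3 + m)
    ≡⟨ ⋆-suc³ cows g m ⟩
  1 * g (3 + m) + (1 * g (2 + m) + (1 * g (1 + m) + ((λ k → cows (2 + k) + cows k) ⋆ g) m))
    ≡⟨ cong (λ z → 1 * g (3 + m) + (1 * g (2 + m) + (1 * g (1 + m) + z)))
            (⋆-distribʳ-+ (cows ∘ (2 +_)) cows g m) ⟩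
  1 * g (3 + m) + (1 * g (2 + m) + (1 * g (1 + m) + (((cows ∘ (2 +_)) ⋆ g) m + (cows ⋆ g) m)))
    ≡⟨ regroup (g (3 + m)) (g (2 + m)) (g (1 + m)) _ _ ⟩
  g (3 + m) + (1 * g (2 + m) + (1 * g (1 + m) + ((cows ∘ (2 +_)) ⋆ g) m)) + (cows ⋆ g) m
    ≡⟨ cong (λ z → g (3 + m) + z + (cows ⋆ g) m) (sym (⋆-suc² cows g m)) ⟩
  g (3 + m) + (cows ⋆ g) (2 + m) + (cows ⋆ g) m ∎
  where
  regroup : ∀ a b c d e → 1 * a + (1 * b + (1 * c + (d + e))) ≡ a + (1 * b + (1 * c + d)) + e
  regroup = solve-∀

pad⋆-rec : ∀ g m → (pad ⋆ g) (3 + m) ≡ g (3 + m) + (pad ⋆ g) (1 + m) + (pad ⋆ g) m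
pad⋆-rec g m = begin
  (pad ⋆ g) (3 + m)
    ≡⟨ ⋆-suc³ pad g m ⟩
  1 * g (3 + m) + (0 * g (2 + m) + (1 * g (1 + m) + ((λ k → pad (1 + k) + pad k) ⋆ g) m))
    ≡⟨ cong (λ z → 1 * g (3 + m) + (0 * g (2 + m) + (1 * g (1 + m) + z)))
            (⋆-distribʳ-+ (pad ∘ suc) pad g m) ⟩
  1 * g (3 + m) + (0 * g (2 + m) + (1 * g (1 + m) + (((pad ∘ suc) ⋆ g) m + (pad ⋆ g) m)))
    ≡⟨ regroup (g (3 + m)) (g (2 + m)) (g (1 + m)) _ _ ⟩
  g (3 + m) + (1 * g (1 + m) + ((pad ∘ suc) ⋆ g) m) + (pad ⋆ g) m
    ≡⟨ cong (λ z → g (3 + m) + z + (pad ⋆ g) m) (sym (⋆-suc pad g m)) ⟩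
  g (3 + m) + (pad ⋆ g) (1 + m) + (pad ⋆ g) m ∎
  where
  regroup : ∀ a b c d e → 1 * a + (0 * b + (1 * c + (d + e))) ≡ a + (1 * c + d) + e
  regroup = solve-∀

pad² : ℕ → ℕ
pad² n = pad n * pad n

pad²-shift-identity : ∀ m →
  pad² (8 + m) + (pad² (4 + m) + pad² (2 + m)) ≡ pad² (7 + m) + pad² (6 + m) + pad² (5 + m) + pad² (3 + m)
pad²-shift-identity m = identity (pad m) (pad (1 + m)) (pad (2 + m))
  where
  identity : ∀ a b c →
    let p3 = b + a ; p4 = c + b ; p5 = p3 + c ; p6 = p4 + p3 ; p7 = p5 + p4 ; p8 = p6 + p5 in
    p8 * p8 + (p4 * p4 + c * c) ≡ p7 * p7 + p6 * p6 + p5 * p5 + p3 * p3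
  identity = solve-∀

pad²-rec : ∀ m → pad² (5 + m) ≡ pad² (3 + m) + pad² (2 + m) + 2 * (cows ⋆ pad²) m
pad²-rec 0 = refl
pad²-rec 1 = refl
pad²-rec 2 = refl
pad²-rec (suc (suc (suc m))) = +-cancelʳ-≡ (pad² (4 + m) + pad² (2 + m)) _ _ (begin
  pad² (8 + m) + (pad² (4 + m) + pad² (2 + m))
    ≡⟨ pad²-shift-identity m ⟩
  pad² (7 + m) + pad² (6 + m) + pad² (5 + m) + pad² (3 + m)
    ≡⟨ cong₂ (λ x y → x + pad² (6 + m) + y + pad² (3 + m)) (pad²-rec (suc (suc m))) (pad²-rec m) ⟩
  pad² (5 + m) + pad² (4 + m) + 2 * E (2 + m) + pad² (6 + m)
    + (pad² (3 + m) + pad² (2 + m) + 2 * E m) + pad² (3 + m)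
    ≡⟨ regroup (pad² (2 + m)) (pad² (3 + m)) (pad² (4 + m)) (pad² (5 + m)) (pad² (6 + m)) (E m) (E (2 + m)) ⟩
  pad² (6 + m) + pad² (5 + m) + 2 * (pad² (3 + m) + E (2 + m) + E m) + (pad² (4 + m) + pad² (2 + m))
    ≡⟨ cong (λ z → pad² (6 + m) + pad² (5 + m) + 2 * z + (pad² (4 + m) + pad² (2 + m)))
            (sym (cows⋆-rec pad² m)) ⟩
  pad² (6 + m) + pad² (5 + m) + 2 * E (3 + m) + (pad² (4 + m) + pad² (2 + m)) ∎)
  where
  E : ℕ → ℕ
  E = cows ⋆ pad²
  regroup : ∀ q2 q3 q4 q5 q6 e0 e2 →
    q5 + q4 + 2 * e2 + q6 + (q3 + q2 + 2 * e0) + q3 ≡ q6 + q5 + 2 * (q3 + e2 + e0) + (q4 + q2)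
  regroup = solve-∀

pad²≡pad+2*pad⋆cows⋆pad² : ∀ N → pad² (5 + N) ≡ pad (5 + N) + 2 * (pad ⋆ (cows ⋆ pad²)) N
pad²≡pad+2*pad⋆cows⋆pad² 0 = refl
pad²≡pad+2*pad⋆cows⋆pad² 1 = refl
pad²≡pad+2*pad⋆cows⋆pad² 2 = refl
pad²≡pad+2*pad⋆cows⋆pad² (suc (suc (suc N))) = begin
  pad² (8 + N)
    ≡⟨ pad²-rec (3 + N) ⟩
  pad² (6 + N) + pad² (5 + N) + 2 * E (3 + N)
    ≡⟨ cong₂ (λ x y → x + y + 2 * E (3 + N))
             (pad²≡pad+2*pad⋆cows⋆pad² (suc N)) (pad²≡pad+2*pad⋆cows⋆pad² N) ⟩
  pad (6 + N) + 2 * S (1 + N) + (pad (5 + N) + 2 * S N) + 2 * E (3 + N)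
    ≡⟨ regroup (pad (6 + N)) (pad (5 + N)) (S (1 + N)) (S N) (E (3 + N)) ⟩
  pad (8 + N) + 2 * (E (3 + N) + S (1 + N) + S N)
    ≡⟨ cong (λ z → pad (8 + N) + 2 * z) (sym (pad⋆-rec E N)) ⟩
  pad (8 + N) + 2 * S (3 + N) ∎
  where
  E S : ℕ → ℕ
  E = cows ⋆ pad²
  S = pad ⋆ E
  regroup : ∀ p6 p5 s1 s0 e3 → p6 + 2 * s1 + (p5 + 2 * s0) + 2 * e3 ≡ p6 + p5 + 2 * (e3 + s1 + s0)
  regroup = solve-∀

innerSum : ℕ → ℕ → ℕ
innerSum a m = sumFromTo 5 m 0 (λ r → cows (r ∸ 5) * a * pad² (m ∸ r))

innerSum-5+ : ∀ a m → innerSum a (5 + m) ≡ a * (cows ⋆ pad²) m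
innerSum-5+ a m = begin
  innerSum a (5 + m)
    ≡⟨ sumRange-shift 5 0 (suc m) _ ⟩
  sumRange 0 (suc m) (λ r → cows r * a * pad² (m ∸ r))
    ≡⟨ sumRange-cong 0 (suc m) (λ r → swap (cows r) a (pad² (m ∸ r))) ⟩
  sumRange 0 (suc m) (λ r → a * (cows r * pad² (m ∸ r)))
    ≡⟨ sumRange-*ˡ 0 (suc m) a _ ⟩
  a * (cows ⋆ pad²) m ∎
  where
  swap : ∀ x y z → x * y * z ≡ y * (x * z)
  swap = solve-∀

-- Generalised over the weights F, since shifting k by one shifts F.
doubleSum≡⋆cows⋆pad² : ∀ (F : ℕ → ℕ) N →
  sumRange 0 (suc N) (λ k → innerSum (F k) ((5 + N) ∸ k)) ≡ (F ⋆ (cows ⋆ pad²)) N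
doubleSum≡⋆cows⋆pad² F zero    = cong (_+ 0) (innerSum-5+ (F 0) 0)
doubleSum≡⋆cows⋆pad² F (suc N) = cong₂ _+_ (innerSum-5+ (F 0) (suc N)) (begin
  sumRange 1 (suc N) (λ k → innerSum (F k) ((6 + N) ∸ k))
    ≡⟨ sumRange-suc 0 (suc N) _ ⟩
  sumRange 0 (suc N) (λ k → innerSum (F (suc k)) ((5 + N) ∸ k))
    ≡⟨ doubleSum≡⋆cows⋆pad² (F ∘ suc) N ⟩
  ((F ∘ suc) ⋆ (cows ⋆ pad²)) N
    ≡⟨ sym (sumRange-suc 0 (suc N) _) ⟩
  sumRange 1 (suc N) (λ k → F k * (cows ⋆ pad²) (suc N ∸ k)) ∎)

mainTheorem18 : (n : ℕ) → pad n * pad n ≡ rhs18 n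
mainTheorem18 0 = refl
mainTheorem18 1 = refl
mainTheorem18 2 = refl
mainTheorem18 3 = refl
mainTheorem18 4 = refl
mainTheorem18 (suc (suc (suc (suc (suc N))))) = begin
  pad² (5 + N)                                   ≡⟨ pad²≡pad+2*pad⋆cows⋆pad² N ⟩
  pad (5 + N) + 2 * (pad ⋆ (cows ⋆ pad²)) N      ≡⟨ cong (λ z → pad (5 + N) + 2 * z)
                                                         (sym (doubleSum≡⋆cows⋆pad² pad N)) ⟩
  rhs18 (5 + N) ∎
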